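{- Let $n\ge1$ and let $\mathcal U(\mathbb H(\mathbb Z_{2^n}))$ be the set of units of $\mathbb H(\mathbb Z_{2^n})$ other than $(1,0,0,0)$ and $(2^n-1,0,0,0)$. Then the vertex connectivity and the edge connectivity of $\Phi(\mathbb H(\mathbb Z_{2^n}))$ satisfy $\kappa(\Phi(\mathbb H(\mathbb Z_{2^n})))=\lambda(\Phi(\mathbb H(\mathbb Z_{2^n})))=|\mathcal U(\mathbb H(\mathbb Z_{2^n}))|$.
   Context: $\mathbb H(\mathbb Z_{2^n})$ is the ring of Hamilton quaternions over $\mathbb Z_{2^n}$. Its elements are $a_1+a_2i+a_3j+a_4k$ with $a_i\in\mathbb Z_{2^n}$, written $(a_1,a_2,a_3,a_4)$. Addition is coordinatewise, and multiplication is determined by distributivity, scalars commuting with $i,j,k$, and $i^2=j^2=k^2=-1$, $ij=-ji=k$, $jk=-kj=i$, $ki=-ik=j$. For a ring $R$ with unity, the non-zero divisor graph $\Phi(R)$ is the simple graph with vertex set $R\setminus\{0,1,-1\}$ in which two distinct vertices $x,y$ are adjacent if and only if $xy\neq0$ or $yx\neq0$. For a non-complete graph, $\kappa$ is the minimum size of a vertex cut and $\lambda$ is the minimum size of an edge cut. -}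

module Defs where

open import Data.Nat using (ℕ; zero; suc; _+_; _*_; _∸_; _^_; _≤_; _<ᵇ_; NonZero)
open import Data.Nat.Properties using (m^n≢0)
open import Data.Nat.DivMod using (_mod_)
open import Data.Fin using (Fin; toℕ) renaming (_≟_ to _≟F_)
open import Data.Bool using (Bool; true; false; _∧_; _∨_; not)
open import Data.List using (List; []; _∷_; length; filter; concatMap; map; allFin)
open import Data.Bool.ListAction using (any)
open import Data.Product using (_×_; _,_; Σ; ∃; proj₁; proj₂)
open import Relation.Nullary using (¬_; Dec; yes; no)
open import Relation.Nullary.Decidable using (⌊_⌋)
open import Relation.Binary.PropositionalEquality using (_≡_; refl)

M : ℕ → ℕ
M n = 2 ^ n


-- wrapped in a record so that n can be inferred from Zn n
record Zn (n : ℕ) : Set where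
  constructor mkZ
  field
    val : Fin (M n)

open Zn public

red : (n : ℕ) → ℕ → Zn n
red n k = mkZ (_mod_ k (M n) {{m^n≢0 2 n}})

module _ {n : ℕ} where
  infixl 6 _⊕_ _⊝_
  infixl 7 _⊗_

  z0 : Zn n
  z0 = red n 0

  z1 : Zn n
  z1 = red n 1

  _⊕_ : Zn n → Zn n → Zn n
  a ⊕ b = red n (toℕ (val a) + toℕ (val b))

  _⊗_ : Zn n → Zn n → Zn n
  a ⊗ b = red n (toℕ (val a) * toℕ (val b))

  ⊖_ : Zn n → Zn n
  ⊖ a = red n (M n ∸ toℕ (val a))

  _⊝_ : Zn n → Zn n → Zn n
  a ⊝ b = a ⊕ (⊖ b)


-- Hamilton quaternions H(Z_{2^n}): a1 + a2 i + a3 j + a4 k.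

record H (n : ℕ) : Set where
  constructor quat
  field
    a1 a2 a3 a4 : Zn n

open H public

module _ {n : ℕ} where
  infixl 7 _·_
  infix 4 _==_

  zeroH : H n
  zeroH = quat z0 z0 z0 z0

  oneH : H n
  oneH = quat z1 z0 z0 z0

  minusOneH : H n
  minusOneH = quat (⊖ z1) z0 z0 z0

  -- i^2 = j^2 = k^2 = -1, ij = k = -ji, jk = i = -kj, ki = j = -ik
  _·_ : H n → H n → H n
  quat a b c d · quat e f g h =
    quat ((((a ⊗ e) ⊝ (b ⊗ f)) ⊝ (c ⊗ g)) ⊝ (d ⊗ h))
         ((((a ⊗ f) ⊕ (b ⊗ e)) ⊕ (c ⊗ h)) ⊝ (d ⊗ g))
         ((((a ⊗ g) ⊝ (b ⊗ h)) ⊕ (c ⊗ e)) ⊕ (d ⊗ f))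
         ((((a ⊗ h) ⊕ (b ⊗ g)) ⊝ (c ⊗ f)) ⊕ (d ⊗ e))

  _≟H_ : (x y : H n) → Dec (x ≡ y)
  quat a b c d ≟H quat e f g h with val a ≟F val e | val b ≟F val f | val c ≟F val g | val d ≟F val h
  ... | yes refl | yes refl | yes refl | yes refl = yes refl
  ... | no p | _ | _ | _ = no λ { refl → p refl }
  ... | yes _ | no p | _ | _ = no λ { refl → p refl }
  ... | yes _ | yes _ | no p | _ = no λ { refl → p refl }
  ... | yes _ | yes _ | yes _ | no p = no λ { refl → p refl }

  _==_ : H n → H n → Bool
  x == y = ⌊ x ≟H y ⌋


allH : (n : ℕ) → List (H n)
allH n = concatMap (λ a → concatMap (λ b → concatMap (λ c → map (λ d → quat a b c d)
           (map mkZ (allFin (M n)))) (map mkZ (allFin (M n)))) (map mkZ (allFin (M n)))) (map mkZ (allFin (M n)))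

allPairs : (n : ℕ) → List (H n × H n)
allPairs n = concatMap (λ x → map (λ y → (x , y)) (allH n)) (allH n)

count : (n : ℕ) → (H n → Bool) → ℕ
count n P = length (filter (λ x → P x ≟B true) (allH n))
  where
  open import Data.Bool.Properties renaming (_≟_ to _≟B_)

-- a total order on H n (lexicographic via a natural-number code),
-- used only to count each unordered pair {x,y} once
code : ∀ {n} → H n → ℕ
code {n} (quat a b c d) = toℕ (val a) + M n * (toℕ (val b) + M n * (toℕ (val c) + M n * toℕ (val d)))

isUnit : ∀ {n} → H n → Bool
isUnit {n} x = any (λ y → (x · y == oneH) ∧ (y · x == oneH)) (allH n)

inU : ∀ {n} → H n → Bool
inU x = isUnit x ∧ not (x == oneH) ∧ not (x == minusOneH)

|U| : ℕ → ℕ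
|U| n = count n inU

isV : ∀ {n} → H n → Bool
isV x = not (x == zeroH) ∧ not (x == oneH) ∧ not (x == minusOneH)

adj : ∀ {n} → H n → H n → Bool
adj x y = isV x ∧ isV y ∧ not (x == y) ∧ (not (x · y == zeroH) ∨ not (y · x == zeroH))

data Walk {V : Set} (Alive : V → Bool) (E : V → V → Bool) : V → V → Set where
  stop : ∀ {x} → Walk Alive E x x
  step : ∀ {x y z} → E x y ≡ true → Alive y ≡ true → Walk Alive E y z → Walk Alive E x z

Disconnected : {V : Set} → (V → Bool) → (V → V → Bool) → Set
Disconnected {V} Alive E =
  Σ V λ u → Σ V λ v → Alive u ≡ true × Alive v ≡ true × ¬ Walk Alive E u v

IsVertexCut : (n : ℕ) → (H n → Bool) → Set
IsVertexCut n S =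
  (∀ x → S x ≡ true → isV x ≡ true) ×
  Disconnected (λ x → isV x ∧ not (S x))
               (λ x y → adj x y ∧ not (S x) ∧ not (S y))

vsize : (n : ℕ) → (H n → Bool) → ℕ
vsize n S = count n S

-- An edge set F: the edge {x,y} belongs to F iff F x y or F y x;
-- F may only mark actual edges.  Φ - F must be disconnected.
removed : ∀ {n} → (H n → H n → Bool) → H n → H n → Bool
removed F x y = F x y ∨ F y x

IsEdgeCut : (n : ℕ) → (H n → H n → Bool) → Set
IsEdgeCut n F =
  (∀ x y → F x y ≡ true → adj x y ≡ true) ×
  Disconnected (isV {n}) (λ x y → adj x y ∧ not (removed F x y))

esize : (n : ℕ) → (H n → H n → Bool) → ℕ
esize n F = length (filter (λ p → P p ≟B true) (allPairs n))
  where
  open import Data.Bool.Properties renaming (_≟_ to _≟B_)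
  P : H n × H n → Bool
  P (x , y) = (code x <ᵇ code y) ∧ adj x y ∧ removed F x y

VertexConnectivity : (n k : ℕ) → Set
VertexConnectivity n k =
  (Σ (H n → Bool) λ S → IsVertexCut n S × vsize n S ≡ k) ×
  (∀ S → IsVertexCut n S → k ≤ vsize n S)

EdgeConnectivity : (n k : ℕ) → Set
EdgeConnectivity n k =
  (Σ (H n → H n → Bool) λ F → IsEdgeCut n F × esize n F ≡ k) ×
  (∀ F → IsEdgeCut n F → k ≤ esize n F)

-- For x = (a,b,c,d) write s(x) = a+b+c+d and N(x) = a²+b²+c²+d².  Modulo 2,
-- s(xy) ≡ s(x)s(y) and N(x) ≡ s(x)², so x is a unit iff s(x) is odd: an odd
-- N(x) is invertible in Z_{2^n} and then x⁻¹ = N(x)⁻¹ x̄.  A unit z is adjacent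
-- to every other vertex, because zx = 0 forces x = 0.  With h = 2^(n-1), the
-- element w = (h,h,h,h) kills every element of even coordinate sum from both
-- sides, so the neighbours of w are exactly the units in U; removing U, or the
-- |U| edges from w to U, therefore isolates w.  Conversely a vertex cut contains
-- every unit of U (one outside the cut would be adjacent to all remaining
-- vertices), and if an edge cut separates u from v, each unit z can be charged a
-- removed edge at z, lying on a path u–z–v (or u–v, u–w–v when z ∈ {u, v}), with
-- distinct units charged distinct edges.

module Submission where

open import Defs
open import Data.Nat using (ℕ; _≤_)
open import Data.Product using (_×_)

open import Algebra.Bundles using (CommutativeRing)
open import Algebra.Solver.Ring.AlmostCommutativeRing
  using (fromCommutativeRing; _-Raw-AlmostCommutative⟶_)
open import Data.Bool using (Bool; true; false; _∧_; _∨_; not; T; if_then_else_)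
open import Data.Bool.Properties
  using (T-≡; T-not-≡; T-∧; T-∨; ∧-conicalˡ; ∧-conicalʳ; ¬-not; ∨-comm) renaming (_≟_ to _≟B_)
open import Data.Empty using (⊥; ⊥-elim)
open import Data.Fin using (#_; toℕ)
import Data.Fin.Properties as Fin
open import Data.Integer as ℤ using (ℤ; +_; -[1+_])
import Data.Integer.Properties as ℤ
open import Data.List using (List; []; _∷_; _++_; map; concatMap; allFin; length; filter)
import Data.List.Properties as List
open import Data.List.Membership.Propositional using (_∈_; lose)
open import Data.List.Membership.Propositional.Properties
  using (∈-map⁺; ∈-allFin; ∈-concatMap⁺; ∈-++⁻; ∈-++⁺ˡ; ∈-++⁺ʳ; ∈-∃++; ∈-filter⁺; ∈-filter⁻)
open import Data.List.Relation.Binary.Sublist.Propositional using (_⊆_; ⊆-refl)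
open import Data.List.Relation.Binary.Sublist.Propositional.Properties using (filter⁺; length-mono-≤)
open import Data.List.Relation.Unary.All as All using (All; _∷_)
import Data.List.Relation.Unary.All.Properties as All
import Data.List.Relation.Unary.AllPairs as AllPairs
import Data.List.Relation.Unary.AllPairs.Properties as AllPairs
open import Data.List.Relation.Unary.Any as Any using (here; there)
open import Data.List.Relation.Unary.Any.Properties using (any⁺; any⁻)
open import Data.List.Relation.Unary.Unique.Propositional using (Unique; _∷_)
import Data.List.Relation.Unary.Unique.Propositional.Properties as Unique
import Data.Maybe as Maybe
open import Data.Nat as ℕ using (zero; suc; _<_; z≤n; s≤s; NonZero)
import Data.Nat.Properties as ℕ
open import Data.Nat.DivMod
  using (_%_; _/_; %-distribˡ-+; %-distribˡ-*; m<n⇒m%n≡m; n%n≡0; m%n<n; m≡m%n+[m/n]*n; [m+kn]%n≡m%n)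
open import Data.Product using (_,_; ∃; proj₁; proj₂)
open import Data.Sum using (_⊎_; inj₁; inj₂; swap)
import Data.Sum as Sum
open import Data.Vec using (Vec; []; _∷_)
open import Function using (_∘_; Equivalence)
open import Level using (0ℓ)
open import Relation.Binary.Consequences using (dec⇒weaklyDec)
open import Relation.Binary.Definitions using (DecidableEquality)
open import Relation.Binary.PropositionalEquality
open import Relation.Nullary using (¬_; Dec; yes; no)
open import Relation.Nullary.Decidable
  using (toWitness; fromWitness; toWitnessFalse; fromWitnessFalse)

open Equivalence using (to; from)

-- The ring Z_{2^n}

module _ {n : ℕ} where

  private instance
    M≢0 : NonZero (M n)
    M≢0 = ℕ.m^n≢0 2 n

  toℕ-red : ∀ k → toℕ (val (red n k)) ≡ k % M n
  toℕ-red k = Fin.toℕ-fromℕ< (m%n<n k (M n))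

  red-cong-% : ∀ {k l} → k % M n ≡ l % M n → red n k ≡ red n l
  red-cong-% {k} {l} eq = cong mkZ (Fin.toℕ-injective (trans (toℕ-red k) (trans eq (sym (toℕ-red l)))))

  red-toℕ : ∀ a → red n (toℕ (val a)) ≡ a
  red-toℕ a = cong mkZ (Fin.toℕ-injective (trans (toℕ-red _) (m<n⇒m%n≡m (Fin.toℕ<n (val a)))))

  red-+ : ∀ k l → red n (k ℕ.+ l) ≡ red n k ⊕ red n l
  red-+ k l = red-cong-% (trans (%-distribˡ-+ k l (M n))
    (cong₂ (λ x y → (x ℕ.+ y) % M n) (sym (toℕ-red k)) (sym (toℕ-red l))))

  red-* : ∀ k l → red n (k ℕ.* l) ≡ red n k ⊗ red n l
  red-* k l = red-cong-% (trans (%-distribˡ-* k l (M n))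
    (cong₂ (λ x y → (x ℕ.* y) % M n) (sym (toℕ-red k)) (sym (toℕ-red l))))

  red-M : red n (M n) ≡ z0
  red-M = red-cong-% (trans (n%n≡0 (M n)) (sym (m<n⇒m%n≡m (ℕ.>-nonZero⁻¹ (M n)))))

  private
    ⊕-redˡ : ∀ k b → red n k ⊕ b ≡ red n (k ℕ.+ toℕ (val b))
    ⊕-redˡ k b = trans (cong (red n k ⊕_) (sym (red-toℕ b))) (sym (red-+ k _))

    ⊕-redʳ : ∀ a k → a ⊕ red n k ≡ red n (toℕ (val a) ℕ.+ k)
    ⊕-redʳ a k = trans (cong (_⊕ red n k) (sym (red-toℕ a))) (sym (red-+ _ k))

    ⊗-redˡ : ∀ k b → red n k ⊗ b ≡ red n (k ℕ.* toℕ (val b))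
    ⊗-redˡ k b = trans (cong (red n k ⊗_) (sym (red-toℕ b))) (sym (red-* k _))

    ⊗-redʳ : ∀ a k → a ⊗ red n k ≡ red n (toℕ (val a) ℕ.* k)
    ⊗-redʳ a k = trans (cong (_⊗ red n k) (sym (red-toℕ a))) (sym (red-* _ k))

  -- Each law is inherited from ℕ along the surjective homomorphism red n.
  ⊕-comm : ∀ a b → a ⊕ b ≡ b ⊕ a
  ⊕-comm a b = cong (red n) (ℕ.+-comm (toℕ (val a)) _)

  ⊗-comm : ∀ a b → a ⊗ b ≡ b ⊗ a
  ⊗-comm a b = cong (red n) (ℕ.*-comm (toℕ (val a)) _)

  ⊕-assoc : ∀ a b c → (a ⊕ b) ⊕ c ≡ a ⊕ (b ⊕ c)
  ⊕-assoc a b c = begin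
    (a ⊕ b) ⊕ c              ≡⟨ ⊕-redˡ _ c ⟩
    red n (A ℕ.+ B ℕ.+ C)    ≡⟨ cong (red n) (ℕ.+-assoc A B C) ⟩
    red n (A ℕ.+ (B ℕ.+ C))  ≡⟨ ⊕-redʳ a _ ⟨
    a ⊕ (b ⊕ c)              ∎
    where open ≡-Reasoning
          A = toℕ (val a); B = toℕ (val b); C = toℕ (val c)

  ⊗-assoc : ∀ a b c → (a ⊗ b) ⊗ c ≡ a ⊗ (b ⊗ c)
  ⊗-assoc a b c = begin
    (a ⊗ b) ⊗ c              ≡⟨ ⊗-redˡ _ c ⟩
    red n (A ℕ.* B ℕ.* C)    ≡⟨ cong (red n) (ℕ.*-assoc A B C) ⟩
    red n (A ℕ.* (B ℕ.* C))  ≡⟨ ⊗-redʳ a _ ⟨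
    a ⊗ (b ⊗ c)              ∎
    where open ≡-Reasoning
          A = toℕ (val a); B = toℕ (val b); C = toℕ (val c)

  ⊕-identityˡ : ∀ a → z0 ⊕ a ≡ a
  ⊕-identityˡ a = trans (⊕-redˡ 0 a) (red-toℕ a)

  ⊗-identityˡ : ∀ a → z1 ⊗ a ≡ a
  ⊗-identityˡ a = trans (⊗-redˡ 1 a) (trans (cong (red n) (ℕ.*-identityˡ _)) (red-toℕ a))

  ⊖-inverseˡ : ∀ a → ⊖ a ⊕ a ≡ z0
  ⊖-inverseˡ a =
    trans (⊕-redˡ _ a) (trans (cong (red n) (ℕ.m∸n+n≡m (ℕ.<⇒≤ (Fin.toℕ<n (val a))))) red-M)

  ⊗-distribˡ-⊕ : ∀ a b c → a ⊗ (b ⊕ c) ≡ (a ⊗ b) ⊕ (a ⊗ c)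
  ⊗-distribˡ-⊕ a b c =
    trans (⊗-redʳ a _) (trans (cong (red n) (ℕ.*-distribˡ-+ (toℕ (val a)) _ _)) (red-+ _ _))

Zn-commutativeRing : ℕ → CommutativeRing 0ℓ 0ℓ
Zn-commutativeRing n = record
  { Carrier = Zn n
  ; _≈_ = _≡_
  ; _+_ = _⊕_
  ; _*_ = _⊗_
  ; -_ = ⊖_
  ; 0# = z0
  ; 1# = z1
  ; isCommutativeRing = record
    { isRing = record
      { +-isAbelianGroup = record
        { isGroup = record
          { isMonoid = record
            { isSemigroup = record
              { isMagma = record { isEquivalence = isEquivalence ; ∙-cong = cong₂ _⊕_ }
              ; assoc = ⊕-assoc
              }
            ; identity = ⊕-identityˡ , λ a → trans (⊕-comm a z0) (⊕-identityˡ a)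
            }
          ; inverse = ⊖-inverseˡ , λ a → trans (⊕-comm a (⊖ a)) (⊖-inverseˡ a)
          ; ⁻¹-cong = cong ⊖_
          }
        ; comm = ⊕-comm
        }
      ; *-cong = cong₂ _⊗_
      ; *-assoc = ⊗-assoc
      ; *-identity = ⊗-identityˡ , λ a → trans (⊗-comm a z1) (⊗-identityˡ a)
      ; distrib = ⊗-distribˡ-⊕ , λ a b c →
          trans (⊗-comm (b ⊕ c) a) (trans (⊗-distribˡ-⊕ a b c) (cong₂ _⊕_ (⊗-comm a b) (⊗-comm a c)))
      }
    ; *-comm = ⊗-comm
    }
  }

module _ {n : ℕ} where
  open CommutativeRing (Zn-commutativeRing n) using (ring; +-assoc)
  open import Algebra.Properties.Ring ring
    using (-0#≈0#; -‿involutive; xyx⁻¹≈y; -‿anti-homo-+; -‿+-comm; -‿distribˡ-*; -‿distribʳ-*)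

  fromℤ : ℤ → Zn n
  fromℤ (+ k) = red n k
  fromℤ -[1+ k ] = ⊖ red n (suc k)

  fromℤ-neg : ∀ z → fromℤ (ℤ.- z) ≡ ⊖ fromℤ z
  fromℤ-neg (+ zero) = sym -0#≈0#
  fromℤ-neg ℤ.+[1+ k ] = refl
  fromℤ-neg -[1+ k ] = sym (-‿involutive _)

  fromℤ-⊖ : ∀ m k → fromℤ (m ℤ.⊖ k) ≡ red n m ⊝ red n k
  fromℤ-⊖ m k with ℕ.≤-total k m
  ... | inj₁ k≤m = begin
    fromℤ (m ℤ.⊖ k)                ≡⟨ cong fromℤ (ℤ.⊖-≥ k≤m) ⟩
    red n d                        ≡⟨ xyx⁻¹≈y (red n k) (red n d) ⟨
    red n k ⊕ red n d ⊝ red n k    ≡⟨ cong (_⊝ red n k) (red-+ k d) ⟨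
    red n (k ℕ.+ d) ⊝ red n k      ≡⟨ cong (λ x → red n x ⊝ red n k) (ℕ.m+[n∸m]≡n k≤m) ⟩
    red n m ⊝ red n k              ∎
    where open ≡-Reasoning
          d = m ℕ.∸ k
  ... | inj₂ m≤k = begin
    fromℤ (m ℤ.⊖ k)                    ≡⟨ cong fromℤ (ℤ.⊖-≤ m≤k) ⟩
    fromℤ (ℤ.- (+ d))                  ≡⟨ fromℤ-neg (+ d) ⟩
    ⊖ red n d                          ≡⟨ xyx⁻¹≈y (red n m) (⊖ red n d) ⟨
    red n m ⊕ ⊖ red n d ⊝ red n m      ≡⟨ +-assoc _ _ _ ⟩
    red n m ⊕ (⊖ red n d ⊝ red n m)    ≡⟨ cong (red n m ⊕_) (-‿anti-homo-+ (red n m) (red n d)) ⟨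
    red n m ⊝ (red n m ⊕ red n d)      ≡⟨ cong (red n m ⊝_) (red-+ m d) ⟨
    red n m ⊝ red n (m ℕ.+ d)          ≡⟨ cong (λ x → red n m ⊝ red n x) (ℕ.m+[n∸m]≡n m≤k) ⟩
    red n m ⊝ red n k                  ∎
    where open ≡-Reasoning
          d = k ℕ.∸ m

  fromℤ-+ : ∀ a b → fromℤ (a ℤ.+ b) ≡ fromℤ a ⊕ fromℤ b
  fromℤ-+ (+ m) (+ k) = red-+ m k
  fromℤ-+ (+ m) -[1+ k ] = fromℤ-⊖ m (suc k)
  fromℤ-+ -[1+ m ] (+ k) = trans (fromℤ-⊖ k (suc m)) (⊕-comm (red n k) (⊖ red n (suc m)))
  fromℤ-+ -[1+ m ] -[1+ k ] = begin
    ⊖ red n (suc (suc (m ℕ.+ k)))        ≡⟨ cong (λ x → ⊖ red n (suc x)) (ℕ.+-suc m k) ⟨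
    ⊖ red n (suc m ℕ.+ suc k)            ≡⟨ cong ⊖_ (red-+ (suc m) (suc k)) ⟩
    ⊖ (red n (suc m) ⊕ red n (suc k))    ≡⟨ -‿+-comm (red n (suc m)) (red n (suc k)) ⟨
    ⊖ red n (suc m) ⊕ ⊖ red n (suc k)    ∎
    where open ≡-Reasoning

  private
    fromℤ-*-+ : ∀ a k → fromℤ (a ℤ.* + k) ≡ fromℤ a ⊗ red n k
    fromℤ-*-+ (+ m) k = trans (cong fromℤ (sym (ℤ.pos-* m k))) (red-* m k)
    fromℤ-*-+ -[1+ m ] k = begin
      fromℤ (-[1+ m ] ℤ.* + k)         ≡⟨ cong fromℤ (ℤ.neg-distribˡ-* (+ suc m) (+ k)) ⟨
      fromℤ (ℤ.- (+ suc m ℤ.* + k))    ≡⟨ cong (fromℤ ∘ ℤ.-_) (ℤ.pos-* (suc m) k) ⟨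
      fromℤ (ℤ.- (+ (suc m ℕ.* k)))    ≡⟨ fromℤ-neg (+ (suc m ℕ.* k)) ⟩
      ⊖ red n (suc m ℕ.* k)            ≡⟨ cong ⊖_ (red-* (suc m) k) ⟩
      ⊖ (red n (suc m) ⊗ red n k)      ≡⟨ -‿distribˡ-* (red n (suc m)) (red n k) ⟩
      ⊖ red n (suc m) ⊗ red n k        ∎
      where open ≡-Reasoning

  fromℤ-* : ∀ a b → fromℤ (a ℤ.* b) ≡ fromℤ a ⊗ fromℤ b
  fromℤ-* a (+ k) = fromℤ-*-+ a k
  fromℤ-* a -[1+ k ] = begin
    fromℤ (a ℤ.* -[1+ k ])           ≡⟨ cong fromℤ (ℤ.neg-distribʳ-* a (+ suc k)) ⟨
    fromℤ (ℤ.- (a ℤ.* + suc k))      ≡⟨ fromℤ-neg (a ℤ.* + suc k) ⟩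
    ⊖ fromℤ (a ℤ.* + suc k)          ≡⟨ cong ⊖_ (fromℤ-*-+ a (suc k)) ⟩
    ⊖ (fromℤ a ⊗ red n (suc k))      ≡⟨ -‿distribʳ-* (fromℤ a) (red n (suc k)) ⟩
    fromℤ a ⊗ ⊖ red n (suc k)        ∎
    where open ≡-Reasoning

-- Integer coefficients keep the solver's normal forms closed terms even though
-- the arithmetic of Z_{2^n} does not compute for a variable n.
module ZnSolver (n : ℕ) where

  ℤ→Zn : ℤ.+-*-rawRing -Raw-AlmostCommutative⟶ fromCommutativeRing (Zn-commutativeRing n)
  ℤ→Zn = record
    { ⟦_⟧ = fromℤ ; +-homo = fromℤ-+ ; *-homo = fromℤ-* ; -‿homo = fromℤ-neg
    ; 0-homo = refl ; 1-homo = refl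
    }

  open import Algebra.Solver.Ring ℤ.+-*-rawRing (fromCommutativeRing (Zn-commutativeRing n)) ℤ→Zn
    (λ a b → Maybe.map (cong fromℤ) (dec⇒weaklyDec ℤ._≟_ a b)) public

  0ₚ 1ₚ 2ₚ : ∀ {k} → Polynomial k
  0ₚ = con (+ 0)
  1ₚ = con (+ 1)
  2ₚ = con (+ 2)

-- Congruence modulo 2

module _ {n : ℕ} where
  open ZnSolver n
  open CommutativeRing (Zn-commutativeRing n) using (zeroˡ; +-identityˡ; +-identityʳ)

  -- red n 2 rather than z1 ⊕ z1, so that two is the value of the solver constant 2ₚ.
  two : Zn n
  two = red n 2

  infix 4 _≡₂_
  _≡₂_ : Zn n → Zn n → Set
  a ≡₂ b = ∃ λ m → a ≡ b ⊕ two ⊗ m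

  ≡₂-refl : ∀ {a} → a ≡₂ a
  ≡₂-refl {a} = z0 , solve 1 (λ a → a := a :+ 2ₚ :* 0ₚ) refl a

  ≡₂-trans : ∀ {a b c} → a ≡₂ b → b ≡₂ c → a ≡₂ c
  ≡₂-trans {c = c} (m , refl) (k , refl) =
    k ⊕ m , solve 3 (λ c k m → c :+ 2ₚ :* k :+ 2ₚ :* m := c :+ 2ₚ :* (k :+ m)) refl c k m

  ≡₂-⊗ : ∀ {a b c d} → a ≡₂ b → c ≡₂ d → a ⊗ c ≡₂ b ⊗ d
  ≡₂-⊗ {b = b} {d = d} (m , refl) (k , refl) =
    b ⊗ k ⊕ m ⊗ d ⊕ two ⊗ m ⊗ k ,
    solve 4 (λ b d m k → (b :+ 2ₚ :* m) :* (d :+ 2ₚ :* k)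
                         := b :* d :+ 2ₚ :* (b :* k :+ m :* d :+ 2ₚ :* m :* k)) refl b d m k

  ⊕-two-⊗⇒≡₂ : ∀ {a b} k → a ⊕ two ⊗ k ≡ b → a ≡₂ b
  ⊕-two-⊗⇒≡₂ {a} k refl = ⊖ k , solve 2 (λ a k → a := a :+ 2ₚ :* k :+ 2ₚ :* (:- k)) refl a k

  even-or-odd : ∀ a → a ≡₂ z0 ⊎ a ≡₂ z1
  even-or-odd a with toℕ (val a) % 2 | m%n<n (toℕ (val a)) 2 | m≡m%n+[m/n]*n (toℕ (val a)) 2
  ... | 0 | _ | A≡ = inj₁ (red n q , (begin
    a                     ≡⟨ red-toℕ a ⟨
    red n (toℕ (val a))   ≡⟨ cong (red n) (trans A≡ (ℕ.*-comm q 2)) ⟩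
    red n (2 ℕ.* q)       ≡⟨ red-* 2 q ⟩
    two ⊗ red n q         ≡⟨ +-identityˡ _ ⟨
    z0 ⊕ two ⊗ red n q    ∎))
    where open ≡-Reasoning
          q = toℕ (val a) / 2
  ... | 1 | _ | A≡ = inj₂ (red n q , (begin
    a                       ≡⟨ red-toℕ a ⟨
    red n (toℕ (val a))     ≡⟨ cong (red n) (trans A≡ (cong suc (ℕ.*-comm q 2))) ⟩
    red n (1 ℕ.+ 2 ℕ.* q)   ≡⟨ red-+ 1 (2 ℕ.* q) ⟩
    z1 ⊕ red n (2 ℕ.* q)    ≡⟨ cong (z1 ⊕_) (red-* 2 q) ⟩
    z1 ⊕ two ⊗ red n q      ∎))
    where open ≡-Reasoning
          q = toℕ (val a) / 2
  ... | suc (suc _) | s≤s (s≤s ()) | _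

  two-torsion-⊗-≡₂ : ∀ {a b} h → h ⊕ h ≡ z0 → a ≡₂ b → h ⊗ a ≡ h ⊗ b
  two-torsion-⊗-≡₂ {b = b} h hh (m , refl) = begin
    h ⊗ (b ⊕ two ⊗ m)      ≡⟨ solve 3 (λ h b m → h :* (b :+ 2ₚ :* m) := h :* b :+ (h :+ h) :* m)
                                      refl h b m ⟩
    h ⊗ b ⊕ (h ⊕ h) ⊗ m    ≡⟨ cong (λ k → h ⊗ b ⊕ k ⊗ m) hh ⟩
    h ⊗ b ⊕ z0 ⊗ m         ≡⟨ cong (h ⊗ b ⊕_) (zeroˡ m) ⟩
    h ⊗ b ⊕ z0             ≡⟨ +-identityʳ (h ⊗ b) ⟩
    h ⊗ b                  ∎
    where open ≡-Reasoning

  -- Lifting an inverse of a = 1 + 2m: if g a = 1 + 2^k c then (g − 2^k c) a = 1 + 2^(k+1) (−c m),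
  -- and at k = n the error term vanishes.
  ≡₂z1⇒invertible : ∀ {a} → a ≡₂ z1 → ∃ λ t → t ⊗ a ≡ z1
  ≡₂z1⇒invertible {a} (m , refl) =
    let g , c , ga≡ = approximate-inverse n in
    g , trans ga≡ (trans (cong (λ q → z1 ⊕ q ⊗ c) red-M) (trans (cong (z1 ⊕_) (zeroˡ c)) (+-identityʳ z1)))
    where
    aₚ : ∀ {k} → Polynomial k → Polynomial k
    aₚ m = 1ₚ :+ 2ₚ :* m
    approximate-inverse : ∀ k → ∃ λ g → ∃ λ c →
                          g ⊗ (z1 ⊕ two ⊗ m) ≡ z1 ⊕ red n (2 ℕ.^ k) ⊗ c
    approximate-inverse zero =
      z0 , ⊖ z1 , solve 1 (λ m → 0ₚ :* aₚ m := 1ₚ :+ 1ₚ :* (:- 1ₚ)) refl m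
    approximate-inverse (suc k) =
      let g , c , ga≡ = approximate-inverse k
          p = red n (2 ℕ.^ k)
          a = z1 ⊕ two ⊗ m
      in g ⊝ p ⊗ c , ⊖ (c ⊗ m) , (begin
      (g ⊝ p ⊗ c) ⊗ a
        ≡⟨ solve 4 (λ g p c m → (g :- p :* c) :* aₚ m := g :* aₚ m :+ p :* (:- c :* aₚ m)) refl g p c m ⟩
      g ⊗ a ⊕ p ⊗ (⊖ c ⊗ a)
        ≡⟨ cong (_⊕ p ⊗ (⊖ c ⊗ a)) ga≡ ⟩
      z1 ⊕ p ⊗ c ⊕ p ⊗ (⊖ c ⊗ a)
        ≡⟨ solve 3 (λ p c m → 1ₚ :+ p :* c :+ p :* (:- c :* aₚ m) := 1ₚ :+ (2ₚ :* p) :* (:- (c :* m)))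
                   refl p c m ⟩
      z1 ⊕ (two ⊗ p) ⊗ ⊖ (c ⊗ m)
        ≡⟨ cong (λ q → z1 ⊕ q ⊗ ⊖ (c ⊗ m)) (red-* 2 (2 ℕ.^ k)) ⟨
      z1 ⊕ red n (2 ℕ.^ suc k) ⊗ ⊖ (c ⊗ m) ∎)
      where open ≡-Reasoning

module _ {j : ℕ} where
  open CommutativeRing (Zn-commutativeRing (suc j)) using (*-identityʳ; zeroʳ)

  half : Zn (suc j)
  half = red (suc j) (2 ℕ.^ j)

  half⊕half≡z0 : half ⊕ half ≡ z0
  half⊕half≡z0 = begin
    half ⊕ half                           ≡⟨ red-+ (2 ℕ.^ j) (2 ℕ.^ j) ⟨
    red (suc j) (2 ℕ.^ j ℕ.+ 2 ℕ.^ j)     ≡⟨ cong (red (suc j) ∘ (2 ℕ.^ j ℕ.+_)) (ℕ.+-identityʳ (2 ℕ.^ j)) ⟨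
    red (suc j) (M (suc j))               ≡⟨ red-M ⟩
    z0                                    ∎
    where open ≡-Reasoning

  half≢z0 : half ≢ z0
  half≢z0 eq = ℕ.<⇒≢ (ℕ.m^n>0 2 j) (sym (begin
    2 ℕ.^ j                      ≡⟨ m<n⇒m%n≡m (ℕ.^-monoʳ-< 2 (ℕ.n<1+n 1) (ℕ.n<1+n j)) ⟨
    2 ℕ.^ j % M (suc j)          ≡⟨ toℕ-red {suc j} (2 ℕ.^ j) ⟨
    toℕ (val half)               ≡⟨ cong (toℕ ∘ val) eq ⟩
    toℕ (val (z0 {suc j}))       ≡⟨ toℕ-red {suc j} 0 ⟩
    0 % M (suc j)                ≡⟨ m<n⇒m%n≡m (ℕ.m^n>0 2 (suc j)) ⟩
    0                            ∎))
    where open ≡-Reasoning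
          instance _ = ℕ.m^n≢0 2 (suc j)

  z1≢₂z0 : ¬ (z1 ≡₂ z0 {suc j})
  z1≢₂z0 z1≡₂z0 = half≢z0 (begin
    half          ≡⟨ *-identityʳ half ⟨
    half ⊗ z1     ≡⟨ two-torsion-⊗-≡₂ half half⊕half≡z0 z1≡₂z0 ⟩
    half ⊗ z0     ≡⟨ zeroʳ half ⟩
    z0            ∎)
    where open ≡-Reasoning

-- Quaternion identities

record Quat (A : Set) : Set where
  constructor ⟨_,_,_,_⟩
  field re im₁ im₂ im₃ : A

module _ {n : ℕ} where
  open ZnSolver n

  private variable k : ℕ

  -- _∙_ copies the clauses of _·_ on solver syntax, so ⟦ P ∙ Q ⟧Q ρ unfolds to a product in H n.
  infixl 7 _∙_
  _∙_ : Quat (Polynomial k) → Quat (Polynomial k) → Quat (Polynomial k)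
  ⟨ a , b , c , d ⟩ ∙ ⟨ e , f , g , h ⟩ =
    ⟨ a :* e :- b :* f :- c :* g :- d :* h
    , a :* f :+ b :* e :+ c :* h :- d :* g
    , a :* g :- b :* h :+ c :* e :+ d :* f
    , a :* h :+ b :* g :- c :* f :+ d :* e ⟩

  ⟦_⟧Q : Quat (Polynomial k) → Vec (Zn n) k → H n
  ⟦ ⟨ a , b , c , d ⟩ ⟧Q ρ = quat (⟦ a ⟧ ρ) (⟦ b ⟧ ρ) (⟦ c ⟧ ρ) (⟦ d ⟧ ρ)

  quat-cong : ∀ {a b c d e f g h : Zn n} →
              a ≡ e → b ≡ f → c ≡ g → d ≡ h → quat a b c d ≡ quat e f g h
  quat-cong refl refl refl refl = refl

  prove-quat : ∀ (P Q : Quat (Polynomial k)) (ρ : Vec (Zn n) k) →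
    ⟦ Quat.re P ⟧↓ ρ ≡ ⟦ Quat.re Q ⟧↓ ρ →
    ⟦ Quat.im₁ P ⟧↓ ρ ≡ ⟦ Quat.im₁ Q ⟧↓ ρ →
    ⟦ Quat.im₂ P ⟧↓ ρ ≡ ⟦ Quat.im₂ Q ⟧↓ ρ →
    ⟦ Quat.im₃ P ⟧↓ ρ ≡ ⟦ Quat.im₃ Q ⟧↓ ρ →
    ⟦ P ⟧Q ρ ≡ ⟦ Q ⟧Q ρ
  prove-quat ⟨ a , b , c , d ⟩ ⟨ e , f , g , h ⟩ ρ p q r s =
    quat-cong (prove ρ a e p) (prove ρ b f q) (prove ρ c g r) (prove ρ d h s)

  coordSum : H n → Zn n
  coordSum x = a1 x ⊕ a2 x ⊕ a3 x ⊕ a4 x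

  norm : H n → Zn n
  norm x = a1 x ⊗ a1 x ⊕ a2 x ⊗ a2 x ⊕ a3 x ⊗ a3 x ⊕ a4 x ⊗ a4 x

  scalar : Zn n → H n
  scalar r = quat r z0 z0 z0

  diag : Zn n → H n
  diag h = quat h h h h

  infixr 8 _⋆_
  _⋆_ : Zn n → H n → H n
  t ⋆ x = quat (t ⊗ a1 x) (t ⊗ a2 x) (t ⊗ a3 x) (t ⊗ a4 x)

  conj : H n → H n
  conj x = quat (a1 x) (⊖ a2 x) (⊖ a3 x) (⊖ a4 x)

  private
    x₀ x₁ x₂ x₃ y₀ y₁ y₂ y₃ : Polynomial 12
    x₀ = var (# 0); x₁ = var (# 1); x₂ = var (# 2); x₃ = var (# 3)
    y₀ = var (# 4); y₁ = var (# 5); y₂ = var (# 6); y₃ = var (# 7)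

    X Y Z : Quat (Polynomial 12)
    X = ⟨ x₀ , x₁ , x₂ , x₃ ⟩
    Y = ⟨ y₀ , y₁ , y₂ , y₃ ⟩
    Z = ⟨ var (# 8) , var (# 9) , var (# 10) , var (# 11) ⟩

    coords : H n → H n → H n → Vec (Zn n) 12
    coords (quat a b c d) (quat e f g h) (quat p q r s) =
      a ∷ b ∷ c ∷ d ∷ e ∷ f ∷ g ∷ h ∷ p ∷ q ∷ r ∷ s ∷ []

    scalarₚ : Polynomial k → Quat (Polynomial k)
    scalarₚ r = ⟨ r , 0ₚ , 0ₚ , 0ₚ ⟩

    sumₚ : Quat (Polynomial k) → Polynomial k
    sumₚ ⟨ a , b , c , d ⟩ = a :+ b :+ c :+ d

    normₚ : Polynomial 12
    normₚ = x₀ :* x₀ :+ x₁ :* x₁ :+ x₂ :* x₂ :+ x₃ :* x₃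

    scaled-conjₚ : Quat (Polynomial 12)
    scaled-conjₚ = ⟨ y₀ :* x₀ , y₀ :* (:- x₁) , y₀ :* (:- x₂) , y₀ :* (:- x₃) ⟩

  ·-assoc : ∀ (x y z : H n) → (x · y) · z ≡ x · (y · z)
  ·-assoc x y z = prove-quat ((X ∙ Y) ∙ Z) (X ∙ (Y ∙ Z)) (coords x y z) refl refl refl refl

  ·-identityˡ : ∀ (x : H n) → oneH · x ≡ x
  ·-identityˡ x = prove-quat (scalarₚ 1ₚ ∙ X) X (coords x x x) refl refl refl refl

  ·-zeroʳ : ∀ (x : H n) → x · zeroH ≡ zeroH
  ·-zeroʳ x = prove-quat (X ∙ scalarₚ 0ₚ) (scalarₚ 0ₚ) (coords x x x) refl refl refl refl

  coordSum-· : ∀ x y → coordSum (x · y) ≡₂ coordSum x ⊗ coordSum y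
  coordSum-· x y =
    ⊕-two-⊗⇒≡₂ _ (prove (coords x y y) (sumₚ (X ∙ Y) :+ 2ₚ :* K) (sumₚ X :* sumₚ Y) refl)
    where
    K : Polynomial 12
    K = x₁ :* y₁ :+ x₁ :* y₃ :+ x₂ :* y₁ :+ x₂ :* y₂ :+ x₃ :* y₂ :+ x₃ :* y₃

  norm-≡₂ : ∀ x → norm x ≡₂ coordSum x ⊗ coordSum x
  norm-≡₂ x = ⊕-two-⊗⇒≡₂ _ (prove (coords x x x) (normₚ :+ 2ₚ :* K) (sumₚ X :* sumₚ X) refl)
    where
    K : Polynomial 12
    K = x₀ :* x₁ :+ x₀ :* x₂ :+ x₀ :* x₃ :+ x₁ :* x₂ :+ x₁ :* x₃ :+ x₂ :* x₃

  ·-scaled-conjʳ : ∀ t x → x · (t ⋆ conj x) ≡ scalar (t ⊗ norm x)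
  ·-scaled-conjʳ t x =
    prove-quat (X ∙ scaled-conjₚ) (scalarₚ (y₀ :* normₚ)) (coords x (scalar t) x) refl refl refl refl

  ·-scaled-conjˡ : ∀ t x → (t ⋆ conj x) · x ≡ scalar (t ⊗ norm x)
  ·-scaled-conjˡ t x =
    prove-quat (scaled-conjₚ ∙ X) (scalarₚ (y₀ :* normₚ)) (coords x (scalar t) x) refl refl refl refl

  -- Each coordinate of diag h · x and x · diag h is h (s(x) + 2e) for some e.
  diag-· : ∀ h → h ⊕ h ≡ z0 → ∀ x → diag h · x ≡ diag (h ⊗ coordSum x)
  diag-· h hh x = trans
    (prove-quat (W ∙ X) ⟨ mod2 (:- (x₁ :+ x₂ :+ x₃)) , mod2 (:- x₂) , mod2 (:- x₃) , mod2 (:- x₁) ⟩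
                (coords x (diag h) x) refl refl refl refl)
    (quat-cong (absorb _) (absorb _) (absorb _) (absorb _))
    where
    W : Quat (Polynomial 12)
    W = ⟨ y₀ , y₀ , y₀ , y₀ ⟩
    mod2 : Polynomial 12 → Polynomial 12
    mod2 e = y₀ :* (sumₚ X :+ 2ₚ :* e)
    absorb : ∀ e → h ⊗ (coordSum x ⊕ two ⊗ e) ≡ h ⊗ coordSum x
    absorb e = two-torsion-⊗-≡₂ h hh (e , refl)

  ·-diag : ∀ h → h ⊕ h ≡ z0 → ∀ x → x · diag h ≡ diag (h ⊗ coordSum x)
  ·-diag h hh x = trans
    (prove-quat (X ∙ W) ⟨ mod2 (:- (x₁ :+ x₂ :+ x₃)) , mod2 (:- x₃) , mod2 (:- x₁) , mod2 (:- x₂) ⟩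
                (coords x (diag h) x) refl refl refl refl)
    (quat-cong (absorb _) (absorb _) (absorb _) (absorb _))
    where
    W : Quat (Polynomial 12)
    W = ⟨ y₀ , y₀ , y₀ , y₀ ⟩
    mod2 : Polynomial 12 → Polynomial 12
    mod2 e = y₀ :* (sumₚ X :+ 2ₚ :* e)
    absorb : ∀ e → h ⊗ (coordSum x ⊕ two ⊗ e) ≡ h ⊗ coordSum x
    absorb e = two-torsion-⊗-≡₂ h hh (e , refl)

  zeroH-even : coordSum (zeroH {n}) ≡₂ z0
  zeroH-even =
    z0 , solve 0 (0ₚ :+ 0ₚ :+ 0ₚ :+ 0ₚ := 0ₚ :+ 2ₚ :* 0ₚ) refl

-- Units of H(Z_{2^n})

module _ {n : ℕ} where
  open CommutativeRing (Zn-commutativeRing n) using (*-identityʳ)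

  Invertible : H n → Set
  Invertible x = ∃ λ y → x · y ≡ oneH × y · x ≡ oneH

  left-invertible-cancel : ∀ {u v x : H n} → v · u ≡ oneH → u · x ≡ zeroH → x ≡ zeroH
  left-invertible-cancel {u} {v} {x} vu≡1 ux≡0 = begin
    x              ≡⟨ ·-identityˡ x ⟨
    oneH · x       ≡⟨ cong (_· x) vu≡1 ⟨
    (v · u) · x    ≡⟨ ·-assoc v u x ⟩
    v · (u · x)    ≡⟨ cong (v ·_) ux≡0 ⟩
    v · zeroH      ≡⟨ ·-zeroʳ v ⟩
    zeroH          ∎
    where open ≡-Reasoning

  odd⇒invertible : ∀ {x} → coordSum x ≡₂ z1 → Invertible x
  odd⇒invertible {x} s≡₂1 =
    t ⋆ conj x , trans (·-scaled-conjʳ t x) (cong scalar tN≡1) , trans (·-scaled-conjˡ t x) (cong scalar tN≡1)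
    where
    N≡₂1 : norm x ≡₂ z1
    N≡₂1 = ≡₂-trans (norm-≡₂ x)
             (subst (coordSum x ⊗ coordSum x ≡₂_) (*-identityʳ z1) (≡₂-⊗ s≡₂1 s≡₂1))
    t = proj₁ (≡₂z1⇒invertible N≡₂1)
    tN≡1 = proj₂ (≡₂z1⇒invertible N≡₂1)

module _ {j : ℕ} where
  open ZnSolver (suc j) using (solve; _:=_; _:+_; 0ₚ; 1ₚ)
  open CommutativeRing (Zn-commutativeRing (suc j)) using (zeroˡ)

  even⇒¬right-invertible : ∀ {x y : H (suc j)} → coordSum x ≡₂ z0 → x · y ≢ oneH
  even⇒¬right-invertible {x} {y} s≡₂0 xy≡1 =
    z1≢₂z0 (subst (_≡₂ z0) (trans (cong coordSum xy≡1) sum-one) (≡₂-trans (coordSum-· x y) sxsy≡₂0))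
    where
    sxsy≡₂0 : coordSum x ⊗ coordSum y ≡₂ z0
    sxsy≡₂0 = subst (coordSum x ⊗ coordSum y ≡₂_) (zeroˡ (coordSum y)) (≡₂-⊗ s≡₂0 (≡₂-refl {a = coordSum y}))
    sum-one : coordSum (oneH {suc j}) ≡ z1
    sum-one = solve 0 (1ₚ :+ 0ₚ :+ 0ₚ :+ 0ₚ := 1ₚ) refl

  ¬invertible⇒even : ∀ {x : H (suc j)} → ¬ Invertible x → coordSum x ≡₂ z0
  ¬invertible⇒even {x} ¬inv =
    Sum.[ (λ even → even) , (λ odd → ⊥-elim (¬inv (odd⇒invertible odd))) ]′ (even-or-odd (coordSum x))

module _ {A B : Set} where

  All-concatMap : ∀ {P : B → Set} (f : A → List B) → (∀ x → All P (f x)) →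
                  ∀ xs → All P (concatMap f xs)
  All-concatMap f Pf xs = All.concat⁺ (All.map⁺ (All.universal Pf xs))

  Unique-concatMap : ∀ (f : A → List B) (g : B → A) → (∀ x → All (λ y → g y ≡ x) (f x)) →
                     (∀ x → Unique (f x)) → ∀ {xs} → Unique xs → Unique (concatMap f xs)
  Unique-concatMap f g fibre uf {xs} uxs =
    Unique.concat⁺ (All.map⁺ (All.universal uf xs)) (AllPairs.map⁺ (AllPairs.map disjoint uxs))
    where
    disjoint : ∀ {x x′} → x ≢ x′ → ∀ {y} → ¬ (y ∈ f x × y ∈ f x′)
    disjoint x≢x′ (y∈fx , y∈fx′) =
      x≢x′ (trans (sym (All.lookup (fibre _) y∈fx)) (All.lookup (fibre _) y∈fx′))

  length-≤-of-injection : ∀ (f : A → B) {xs : List A} (ys : List B) → Unique xs →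
    (∀ {a} → a ∈ xs → f a ∈ ys) → (∀ {a b} → a ∈ xs → b ∈ xs → f a ≡ f b → a ≡ b) →
    length xs ≤ length ys
  length-≤-of-injection f {[]} ys _ _ _ = z≤n
  length-≤-of-injection f {x ∷ xs} ys (x∉xs ∷ uxs) into inj with ∈-∃++ (into (here refl))
  ... | ys₁ , ys₂ , refl = ℕ.≤-trans (s≤s (length-≤-of-injection f (ys₁ ++ ys₂) uxs into′ inj′))
                                     (ℕ.≤-reflexive (sym (List.length-++-sucʳ ys₁ (f x) ys₂)))
    where
    inj′ : ∀ {a b} → a ∈ xs → b ∈ xs → f a ≡ f b → a ≡ b
    inj′ a∈ b∈ = inj (there a∈) (there b∈)
    into′ : ∀ {a} → a ∈ xs → f a ∈ ys₁ ++ ys₂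
    into′ a∈ with ∈-++⁻ ys₁ (into (there a∈))
    ... | inj₁ p = ∈-++⁺ˡ p
    ... | inj₂ (here fa≡fx) = ⊥-elim (All.lookup x∉xs a∈ (inj (here refl) (there a∈) (sym fa≡fx)))
    ... | inj₂ (there p) = ∈-++⁺ʳ ys₁ p

module _ {n : ℕ} where
  private
    Zs : List (Zn n)
    Zs = map mkZ (allFin (M n))

    ∈-Zs : ∀ a → a ∈ Zs
    ∈-Zs (mkZ i) = ∈-map⁺ mkZ (∈-allFin i)

    Zs-unique : Unique Zs
    Zs-unique = Unique.map⁺ (cong val) (Unique.allFin⁺ (M n))

  ∈-allH : ∀ x → x ∈ allH n
  ∈-allH (quat a b c d) = ∈-concatMap⁺ _ (lose (∈-Zs a) (∈-concatMap⁺ _ (lose (∈-Zs b)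
                            (∈-concatMap⁺ _ (lose (∈-Zs c) (∈-map⁺ (quat a b c) (∈-Zs d)))))))

  allH-unique : Unique (allH n)
  allH-unique =
    Unique-concatMap _ a1 (λ a → All-concatMap _ (λ b → All-concatMap _ (λ c → fibre (quat a b c) (λ _ → refl)) Zs) Zs)
      (λ a → Unique-concatMap _ a2 (λ b → All-concatMap _ (λ c → fibre (quat a b c) (λ _ → refl)) Zs)
        (λ b → Unique-concatMap _ a3 (λ c → fibre (quat a b c) (λ _ → refl))
          (λ c → Unique.map⁺ (cong a4) Zs-unique) Zs-unique) Zs-unique) Zs-unique
    where
    fibre : ∀ {P : H n → Set} (q : Zn n → H n) → (∀ d → P (q d)) → All P (map q Zs)
    fibre q Pq = All.map⁺ (All.universal Pq Zs)

  ∈-allPairs : ∀ x y → (x , y) ∈ allPairs n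
  ∈-allPairs x y = ∈-concatMap⁺ _ (lose (∈-allH x) (∈-map⁺ (x ,_) (∈-allH y)))

  allPairs-unique : Unique (allPairs n)
  allPairs-unique = Unique-concatMap _ proj₁ (λ x → All.map⁺ (All.universal (λ _ → refl) (allH n)))
    (λ x → Unique.map⁺ (cong proj₂) allH-unique) allH-unique

  count-mono : ∀ {P Q : H n → Bool} → (∀ x → P x ≡ true → Q x ≡ true) → count n P ≤ count n Q
  count-mono {P} {Q} P⇒Q =
    length-mono-≤ (filter⁺ (λ x → P x ≟B true) (λ x → Q x ≟B true) (λ { refl → P⇒Q _ }) allH⊆allH)
    where
    allH⊆allH : allH n ⊆ allH n
    allH⊆allH = ⊆-refl

  private instance
    M≢0 : NonZero (M n)
    M≢0 = ℕ.m^n≢0 2 n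

  private
    digits-injective : ∀ {a b r s} → a < M n → b < M n →
                       a ℕ.+ M n ℕ.* r ≡ b ℕ.+ M n ℕ.* s → a ≡ b × r ≡ s
    digits-injective {a} {b} {r} {s} a< b< eq =
      a≡b , ℕ.*-cancelˡ-≡ r s (M n) (ℕ.+-cancelˡ-≡ a _ _ (trans eq (cong (ℕ._+ M n ℕ.* s) (sym a≡b))))
      where
      low : ∀ {c} t → c < M n → (c ℕ.+ M n ℕ.* t) % M n ≡ c
      low {c} t c< = trans (cong (λ u → (c ℕ.+ u) % M n) (ℕ.*-comm (M n) t))
                           (trans ([m+kn]%n≡m%n c t (M n)) (m<n⇒m%n≡m c<))
      a≡b : a ≡ b
      a≡b = trans (sym (low r a<)) (trans (cong (_% M n) eq) (low s b<))

    toℕ-val-injective : ∀ {a b : Zn n} → toℕ (val a) ≡ toℕ (val b) → a ≡ b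
    toℕ-val-injective eq = cong mkZ (Fin.toℕ-injective eq)

  code-injective : ∀ {x y : H n} → code x ≡ code y → x ≡ y
  code-injective {quat a b c d} {quat a′ b′ c′ d′} eq
    with digits-injective (Fin.toℕ<n (val a)) (Fin.toℕ<n (val a′)) eq
  ... | a≡ , eq₁ with digits-injective (Fin.toℕ<n (val b)) (Fin.toℕ<n (val b′)) eq₁
  ... | b≡ , eq₂ with digits-injective (Fin.toℕ<n (val c)) (Fin.toℕ<n (val c′)) eq₂
  ... | c≡ , d≡ rewrite toℕ-val-injective {a} a≡ | toℕ-val-injective {b} b≡
                      | toℕ-val-injective {c} c≡ | toℕ-val-injective {d} d≡ = refl

module _ {A : Set} where

  infix 4 _≈ᵤ_
  _≈ᵤ_ : A × A → A × A → Set
  (a , b) ≈ᵤ (c , d) = (a ≡ c × b ≡ d) ⊎ (a ≡ d × b ≡ c)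

  ≈ᵤ-sym : ∀ {p q} → p ≈ᵤ q → q ≈ᵤ p
  ≈ᵤ-sym (inj₁ (refl , refl)) = inj₁ (refl , refl)
  ≈ᵤ-sym (inj₂ (refl , refl)) = inj₂ (refl , refl)

  ≈ᵤ-trans : ∀ {p q r} → p ≈ᵤ q → q ≈ᵤ r → p ≈ᵤ r
  ≈ᵤ-trans (inj₁ (refl , refl)) q≈r = q≈r
  ≈ᵤ-trans (inj₂ (refl , refl)) (inj₁ (refl , refl)) = inj₂ (refl , refl)
  ≈ᵤ-trans (inj₂ (refl , refl)) (inj₂ (refl , refl)) = inj₁ (refl , refl)

  module _ (key : A → ℕ) where

    sortPair : A → A → A × A
    sortPair a b = if key a ℕ.<ᵇ key b then (a , b) else (b , a)

    sortPair-≈ᵤ : ∀ a b → sortPair a b ≈ᵤ (a , b)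
    sortPair-≈ᵤ a b with key a ℕ.<ᵇ key b
    ... | true = inj₁ (refl , refl)
    ... | false = inj₂ (refl , refl)

    sortPair-sorted : ∀ a b → key a ≢ key b → key (proj₁ (sortPair a b)) < key (proj₂ (sortPair a b))
    sortPair-sorted a b ka≢kb with key a ℕ.<ᵇ key b in eq
    ... | true = ℕ.<ᵇ⇒< (key a) (key b) (subst T (sym eq) _)
    ... | false = ℕ.≤∧≢⇒< (ℕ.≮⇒≥ (λ lt → subst T eq (ℕ.<⇒<ᵇ lt))) (ka≢kb ∘ sym)

    sorted-≈ᵤ⇒≡ : ∀ {p q} → key (proj₁ p) < key (proj₂ p) → key (proj₁ q) < key (proj₂ q) →
                  p ≈ᵤ q → p ≡ q
    sorted-≈ᵤ⇒≡ _ _ (inj₁ (refl , refl)) = refl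
    sorted-≈ᵤ⇒≡ p< q< (inj₂ (refl , refl)) = ⊥-elim (ℕ.<-asym p< q<)

module _ {V : Set} {Alive : V → Bool} {E : V → V → Bool} where

  isolated⇒¬walk : ∀ {u v} → u ≢ v → (∀ y → E u y ≡ true → Alive y ≡ true → ⊥) →
                   ¬ Walk Alive E u v
  isolated⇒¬walk u≢v isolated stop = u≢v refl
  isolated⇒¬walk u≢v isolated (step e ay _) = isolated _ e ay

  dominating⇒walk : DecidableEquality V → ∀ {z} → Alive z ≡ true →
    (∀ x → Alive x ≡ true → x ≢ z → E x z ≡ true × E z x ≡ true) →
    ∀ {a b} → Alive a ≡ true → Alive b ≡ true → Walk Alive E a b
  dominating⇒walk _≟_ {z} az dominates {a} {b} aa ab with a ≟ z | b ≟ z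
  ... | yes refl | yes refl = stop
  ... | yes refl | no b≢z = step (proj₂ (dominates b ab b≢z)) ab stop
  ... | no a≢z | yes refl = step (proj₁ (dominates a aa a≢z)) az stop
  ... | no a≢z | no b≢z = step (proj₁ (dominates a aa a≢z)) az (step (proj₂ (dominates b ab b≢z)) ab stop)

module _ {n : ℕ} where

  private
    ≢⇒T-not-== : ∀ {x y : H n} → x ≢ y → T (not (x == y))
    ≢⇒T-not-== {x} {y} = fromWitnessFalse {a? = x ≟H y}

    T-not-==⇒≢ : ∀ {x y : H n} → T (not (x == y)) → x ≢ y
    T-not-==⇒≢ {x} {y} = toWitnessFalse {a? = x ≟H y}

  ==⇒≡ : ∀ {x y : H n} → (x == y) ≡ true → x ≡ y
  ==⇒≡ {x} {y} eq = toWitness {a? = x ≟H y} (from T-≡ eq)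

  ==-refl : ∀ (x : H n) → (x == x) ≡ true
  ==-refl x = to T-≡ (fromWitness {a? = x ≟H x} refl)

  ≢⇒==false : ∀ {x y : H n} → x ≢ y → (x == y) ≡ false
  ≢⇒==false = to T-not-≡ ∘ ≢⇒T-not-==

  isV-intro : ∀ {x : H n} → x ≢ zeroH → x ≢ oneH → x ≢ minusOneH → isV x ≡ true
  isV-intro x≢0 x≢1 x≢-1 =
    to T-≡ (from T-∧ (≢⇒T-not-== x≢0 , from T-∧ (≢⇒T-not-== x≢1 , ≢⇒T-not-== x≢-1)))

  isV-elim : ∀ {x : H n} → isV x ≡ true → x ≢ zeroH × x ≢ oneH × x ≢ minusOneH
  isV-elim {x} vx = T-not-==⇒≢ (proj₁ parts) , T-not-==⇒≢ (proj₁ rest) , T-not-==⇒≢ (proj₂ rest)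
    where
    parts = to T-∧ (from T-≡ vx)
    rest = to T-∧ (proj₂ parts)

  inU-intro : ∀ {x : H n} → isUnit x ≡ true → x ≢ oneH → x ≢ minusOneH → inU x ≡ true
  inU-intro ux x≢1 x≢-1 =
    to T-≡ (from T-∧ (from T-≡ ux , from T-∧ (≢⇒T-not-== x≢1 , ≢⇒T-not-== x≢-1)))

  inU-elim : ∀ {x : H n} → inU x ≡ true → isUnit x ≡ true × x ≢ oneH × x ≢ minusOneH
  inU-elim {x} ux = to T-≡ (proj₁ parts) , T-not-==⇒≢ (proj₁ rest) , T-not-==⇒≢ (proj₂ rest)
    where
    parts = to T-∧ (from T-≡ ux)
    rest = to T-∧ (proj₂ parts)

  adj-intro : ∀ {x y : H n} → isV x ≡ true → isV y ≡ true → x ≢ y →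
              x · y ≢ zeroH ⊎ y · x ≢ zeroH → adj x y ≡ true
  adj-intro vx vy x≢y nonzero = to T-≡ (from T-∧ (from T-≡ vx , from T-∧ (from T-≡ vy ,
    from T-∧ (≢⇒T-not-== x≢y , from T-∨ (Sum.map ≢⇒T-not-== ≢⇒T-not-== nonzero)))))

  adj-elim : ∀ {x y : H n} → adj x y ≡ true →
             isV x ≡ true × isV y ≡ true × x ≢ y × (x · y ≢ zeroH ⊎ y · x ≢ zeroH)
  adj-elim {x} {y} a = to T-≡ (proj₁ parts₁) , to T-≡ (proj₁ parts₂) , T-not-==⇒≢ (proj₁ parts₃)
                     , Sum.map T-not-==⇒≢ T-not-==⇒≢ (to T-∨ (proj₂ parts₃))
    where
    parts₁ = to T-∧ (from T-≡ a)
    parts₂ = to T-∧ (proj₂ parts₁)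
    parts₃ = to T-∧ (proj₂ parts₂)

  adj-sym : ∀ {x y : H n} → adj x y ≡ true → adj y x ≡ true
  adj-sym {x} {y} a =
    let vx , vy , x≢y , nonzero = adj-elim {x = x} {y = y} a
    in adj-intro {x = y} {y = x} vy vx (x≢y ∘ sym) (swap nonzero)

  isUnit⇒invertible : ∀ {x : H n} → isUnit x ≡ true → Invertible x
  isUnit⇒invertible {x} ux =
    y , toWitness {a? = (x · y) ≟H oneH} (proj₁ y-inverse)
      , toWitness {a? = (y · x) ≟H oneH} (proj₂ y-inverse)
    where
    witness = Any.satisfied (any⁻ _ (allH n) (from T-≡ ux))
    y = proj₁ witness
    y-inverse = to T-∧ (proj₂ witness)

  invertible⇒isUnit : ∀ {x : H n} → Invertible x → isUnit x ≡ true
  invertible⇒isUnit {x} (y , xy≡1 , yx≡1) = to T-≡ (any⁺ _ (lose (∈-allH y)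
    (from T-∧ (fromWitness {a? = (x · y) ≟H oneH} xy≡1 , fromWitness {a? = (y · x) ≟H oneH} yx≡1))))

module _ {n : ℕ} where

  U-list : List (H n)
  U-list = filter (λ x → inU x ≟B true) (allH n)

  U-list-unique : Unique U-list
  U-list-unique = Unique.filter⁺ _ allH-unique

  ∈-U-list : ∀ {x} → inU x ≡ true → x ∈ U-list
  ∈-U-list {x} ux = ∈-filter⁺ (λ x → inU x ≟B true) (∈-allH x) ux

  ∈-U-list⁻ : ∀ {x} → x ∈ U-list → inU x ≡ true
  ∈-U-list⁻ m = proj₂ (∈-filter⁻ (λ x → inU x ≟B true) {xs = allH n} m)

  -- esize n F is, by definition, the length of cutEdges F.
  IsCutEdge : (H n → H n → Bool) → H n × H n → Bool
  IsCutEdge F (x , y) = (code x ℕ.<ᵇ code y) ∧ adj x y ∧ removed F x y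

  cutEdges : (H n → H n → Bool) → List (H n × H n)
  cutEdges F = filter (λ p → IsCutEdge F p ≟B true) (allPairs n)

  cutEdges-unique : ∀ F → Unique (cutEdges F)
  cutEdges-unique F = Unique.filter⁺ _ allPairs-unique

  cutEdges⁻ : ∀ F {p} → p ∈ cutEdges F →
              code (proj₁ p) < code (proj₂ p) × removed F (proj₁ p) (proj₂ p) ≡ true
  cutEdges⁻ F {x , y} m =
    ℕ.<ᵇ⇒< _ _ (proj₁ parts) , to T-≡ (proj₂ (to T-∧ (proj₂ parts)))
    where parts = to T-∧ (from T-≡ (proj₂ (∈-filter⁻ (λ p → IsCutEdge F p ≟B true) {xs = allPairs n} m)))

  removed-sym : ∀ F (x y : H n) → removed F x y ≡ removed F y x
  removed-sym F x y = ∨-comm (F x y) (F y x)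

  sortByCode : H n → H n → H n × H n
  sortByCode = sortPair code

  ∈-cutEdges : ∀ F {x y} → x ≢ y → adj x y ≡ true → removed F x y ≡ true →
               sortByCode x y ∈ cutEdges F
  ∈-cutEdges F {x} {y} x≢y a r = ∈-filter⁺ (λ p → IsCutEdge F p ≟B true) (∈-allPairs _ _)
    (to T-≡ (from T-∧ (ℕ.<⇒<ᵇ (sortPair-sorted code x y (x≢y ∘ code-injective)) ,
      from T-∧ (from T-≡ (sym-on (λ {x} {y} → adj-sym {x = x} {y = y}) a) ,
                from T-≡ (sym-on (λ {x} {y} → trans (removed-sym F y x)) r)))))
    where
    sym-on : ∀ {P : H n → H n → Set} → (∀ {x y} → P x y → P y x) → P x y →
             P (proj₁ (sortByCode x y)) (proj₂ (sortByCode x y))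
    sym-on {P} P-sym pxy with sortByCode x y | sortPair-≈ᵤ code x y
    ... | _ | inj₁ (refl , refl) = pxy
    ... | _ | inj₂ (refl , refl) = P-sym pxy

-- Vertex and edge connectivity of Φ(H(Z_{2^n})), n = j + 1

module _ {j : ℕ} where
  open ZnSolver (suc j) using (solve; _:=_; _:+_; _:*_; 0ₚ; 1ₚ; 2ₚ)
  open CommutativeRing (Zn-commutativeRing (suc j)) using (zeroʳ)

  private
    𝐇 : Set
    𝐇 = H (suc j)

    false≢true : false ≢ true
    false≢true ()

  even⇒¬isUnit : ∀ {x : 𝐇} → coordSum x ≡₂ z0 → isUnit x ≢ true
  even⇒¬isUnit {x} even ux =
    let y , xy≡1 , _ = isUnit⇒invertible ux in even⇒¬right-invertible {x = x} {y = y} even xy≡1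

  even⇒not-inU : ∀ {x : 𝐇} → coordSum x ≡₂ z0 → not (inU x) ≡ true
  even⇒not-inU {x} even = cong not (¬-not (even⇒¬isUnit even ∘ proj₁ ∘ inU-elim {x = x}))

  inU⇒isV : ∀ {x : 𝐇} → inU x ≡ true → isV x ≡ true
  inU⇒isV {x} ux = let u , x≢1 , x≢-1 = inU-elim {x = x} ux in
    isV-intro (λ { refl → even⇒¬isUnit zeroH-even u }) x≢1 x≢-1

  unit-adjacent : ∀ {z x : 𝐇} → inU z ≡ true → isV x ≡ true → z ≢ x → adj z x ≡ true
  unit-adjacent {z} {x} uz vx z≢x = adj-intro (inU⇒isV uz) vx z≢x (inj₁ zx≢0)
    where
    zx≢0 : z · x ≢ zeroH
    zx≢0 zx≡0 = let v , _ , vz≡1 = isUnit⇒invertible (proj₁ (inU-elim {x = z} uz)) in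
      proj₁ (isV-elim {x = x} vx) (left-invertible-cancel {u = z} {v = v} vz≡1 zx≡0)

  w v₀ : 𝐇
  w = diag half
  v₀ = quat z1 z1 z0 z0

  w-even : coordSum w ≡₂ z0
  w-even = half ⊕ half , solve 1 (λ h → h :+ h :+ h :+ h := 0ₚ :+ 2ₚ :* (h :+ h)) refl half

  v₀-even : coordSum v₀ ≡₂ z0
  v₀-even = z1 , solve 0 (1ₚ :+ 1ₚ :+ 0ₚ :+ 0ₚ := 0ₚ :+ 2ₚ :* 1ₚ) refl

  w-isV : isV w ≡ true
  w-isV = isV-intro {x = w} (half≢z0 ∘ cong a2) (half≢z0 ∘ cong a2) (half≢z0 ∘ cong a2)

  v₀-isV : isV v₀ ≡ true
  v₀-isV = isV-intro {x = v₀} (z1≢z0 ∘ cong a2) (z1≢z0 ∘ cong a2) (z1≢z0 ∘ cong a2)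
    where
    z1≢z0 : z1 {suc j} ≢ z0
    z1≢z0 eq = z1≢₂z0 (subst (z1 ≡₂_) eq (≡₂-refl {a = z1}))

  w≢v₀ : w ≢ v₀
  w≢v₀ = half≢z0 ∘ cong a3

  inU⇒≢w : ∀ {x : 𝐇} → inU x ≡ true → x ≢ w
  inU⇒≢w ux refl = false≢true (trans (sym (cong not ux)) (even⇒not-inU w-even))

  w-annihilates-even : ∀ {x} → coordSum x ≡₂ z0 → w · x ≡ zeroH × x · w ≡ zeroH
  w-annihilates-even {x} even =
      trans (diag-· half half⊕half≡z0 x) (cong diag half-sum≡0)
    , trans (·-diag half half⊕half≡z0 x) (cong diag half-sum≡0)
    where
    half-sum≡0 : half ⊗ coordSum x ≡ z0
    half-sum≡0 = trans (two-torsion-⊗-≡₂ half half⊕half≡z0 even) (zeroʳ half)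

  adj-w⇒inU : ∀ {y : 𝐇} → adj w y ≡ true → inU y ≡ true
  adj-w⇒inU {y} a = ¬-not non-unit-absurd
    where
    y-facts = adj-elim {x = w} {y = y} a
    y≢±1 = proj₂ (isV-elim {x = y} (proj₁ (proj₂ y-facts)))
    refute : w · y ≡ zeroH × y · w ≡ zeroH → w · y ≢ zeroH ⊎ y · w ≢ zeroH → ⊥
    refute (wy≡0 , _) (inj₁ wy≢0) = wy≢0 wy≡0
    refute (_ , yw≡0) (inj₂ yw≢0) = yw≢0 yw≡0
    non-unit-absurd : inU y ≢ false
    non-unit-absurd uy = refute (w-annihilates-even (¬invertible⇒even λ inv →
      false≢true (trans (sym uy) (inU-intro (invertible⇒isUnit inv) (proj₁ y≢±1) (proj₂ y≢±1)))))
      (proj₂ (proj₂ (proj₂ y-facts)))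

  U-isVertexCut : IsVertexCut (suc j) inU
  U-isVertexCut = (λ x → inU⇒isV {x = x}) , w , v₀
                , cong₂ _∧_ w-isV (even⇒not-inU w-even) , cong₂ _∧_ v₀-isV (even⇒not-inU v₀-even)
                , isolated⇒¬walk w≢v₀ w-isolated
    where
    w-isolated : ∀ (y : 𝐇) → adj w y ∧ not (inU w) ∧ not (inU y) ≡ true → isV y ∧ not (inU y) ≡ true → ⊥
    w-isolated y e ay =
      false≢true (trans (sym (cong not (adj-w⇒inU (∧-conicalˡ (adj w y) _ e)))) (∧-conicalʳ (isV y) _ ay))

  U⊆vertexCut : ∀ {S} → IsVertexCut (suc j) S → ∀ z → inU z ≡ true → S z ≡ true
  U⊆vertexCut {S} (_ , a , b , aa , ab , ¬walk) z uz =
    ¬-not (λ Sz≡false → ¬walk (dominating⇒walk _≟H_ (alive-z Sz≡false) (dominates Sz≡false) aa ab))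
    where
    alive-z : S z ≡ false → isV z ∧ not (S z) ≡ true
    alive-z Sz≡false = cong₂ _∧_ (inU⇒isV uz) (cong not Sz≡false)
    dominates : S z ≡ false → ∀ x → isV x ∧ not (S x) ≡ true → x ≢ z →
                adj x z ∧ not (S x) ∧ not (S z) ≡ true × adj z x ∧ not (S z) ∧ not (S x) ≡ true
    dominates Sz≡false x ax x≢z =
        cong₂ _∧_ (adj-sym {x = z} {y = x} z~x) (cong₂ _∧_ (∧-conicalʳ _ _ ax) (cong not Sz≡false))
      , cong₂ _∧_ z~x (cong₂ _∧_ (cong not Sz≡false) (∧-conicalʳ _ _ ax))
      where z~x = unit-adjacent uz (∧-conicalˡ _ _ ax) (x≢z ∘ sym)

  F₀ : 𝐇 → 𝐇 → Bool
  F₀ x y = (x == w) ∧ inU y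

  F₀-isEdgeCut : IsEdgeCut (suc j) F₀
  F₀-isEdgeCut = F₀⊆adj , w , v₀ , w-isV , v₀-isV , isolated⇒¬walk w≢v₀ w-isolated
    where
    F₀⊆adj : ∀ x y → F₀ x y ≡ true → adj x y ≡ true
    F₀⊆adj x y e with ==⇒≡ {x = x} {y = w} (∧-conicalˡ _ _ e)
    ... | refl = adj-sym {x = y} {y = w} (unit-adjacent uy w-isV (inU⇒≢w uy))
      where uy = ∧-conicalʳ (w == w) _ e
    w-isolated : ∀ (y : 𝐇) → adj w y ∧ not (removed F₀ w y) ≡ true → isV y ≡ true → ⊥
    w-isolated y e _ = false≢true (trans (sym (cong not w-y-removed)) (∧-conicalʳ (adj w y) _ e))
      where
      w-y-removed : removed F₀ w y ≡ true
      w-y-removed = cong (_∨ F₀ y w) (cong₂ _∧_ (==-refl w) (adj-w⇒inU (∧-conicalˡ (adj w y) _ e)))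

  F₀-size≤|U| : esize (suc j) F₀ ≤ |U| (suc j)
  F₀-size≤|U| =
    length-≤-of-injection otherEnd (U-list {suc j}) (cutEdges-unique F₀) (∈-U-list ∘ proj₂ ∘ shape) injective
    where
    otherEnd : 𝐇 × 𝐇 → 𝐇
    otherEnd (x , y) = if x == w then y else x
    shape : ∀ {p} → p ∈ cutEdges F₀ → p ≈ᵤ (w , otherEnd p) × inU (otherEnd p) ≡ true
    shape {x , y} m = by-cases (to (T-∨ {F₀ x y} {F₀ y x}) (from T-≡ (proj₂ (cutEdges⁻ F₀ m))))
      where
      by-cases : T (F₀ x y) ⊎ T (F₀ y x) →
                 (x , y) ≈ᵤ (w , otherEnd (x , y)) × inU (otherEnd (x , y)) ≡ true
      by-cases (inj₁ t) =
        inj₁ (==⇒≡ {x = x} {y = w} xw , sym end≡y) , subst (λ e → inU e ≡ true) (sym end≡y) uy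
        where
        xw = to T-≡ (proj₁ (to (T-∧ {x == w} {inU y}) t))
        uy = to T-≡ (proj₂ (to (T-∧ {x == w} {inU y}) t))
        end≡y : otherEnd (x , y) ≡ y
        end≡y = cong (λ b → if b then y else x) xw
      by-cases (inj₂ t) =
        inj₂ (sym end≡x , ==⇒≡ {x = y} {y = w} yw) , subst (λ e → inU e ≡ true) (sym end≡x) ux
        where
        yw = to T-≡ (proj₁ (to (T-∧ {y == w} {inU x}) t))
        ux = to T-≡ (proj₂ (to (T-∧ {y == w} {inU x}) t))
        end≡x : otherEnd (x , y) ≡ x
        end≡x = cong (λ b → if b then y else x) (≢⇒==false {x = x} {y = w} (inU⇒≢w ux))
    injective : ∀ {p q} → p ∈ cutEdges F₀ → q ∈ cutEdges F₀ → otherEnd p ≡ otherEnd q → p ≡ q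
    injective {p} {q} mp mq eq =
      sorted-≈ᵤ⇒≡ code (proj₁ (cutEdges⁻ F₀ mp)) (proj₁ (cutEdges⁻ F₀ mq))
        (≈ᵤ-trans (proj₁ (shape mp)) (subst (λ e → (w , e) ≈ᵤ q) (sym eq) (≈ᵤ-sym (proj₁ (shape mq)))))

  module _ (F : 𝐇 → 𝐇 → Bool) {u v : 𝐇} (vu : isV u ≡ true) (vv : isV v ≡ true)
           (¬walk : ¬ Walk isV (λ x y → adj x y ∧ not (removed F x y)) u v) where

    private
      u≢v : u ≢ v
      u≢v refl = ¬walk stop

      removed-if-adj : adj u v ≡ true → removed F u v ≡ true
      removed-if-adj a = ¬-not (λ r → ¬walk (step (cong₂ _∧_ a (cong not r)) vv stop))

      removed-on-path : ∀ {z} → isV z ≡ true → adj u z ≡ true → adj z v ≡ true →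
                        removed F u z ≡ false → removed F z v ≡ true
      removed-on-path vz a₁ a₂ r₁ =
        ¬-not λ r₂ → ¬walk (step (cong₂ _∧_ a₁ (cong not r₁)) vz (step (cong₂ _∧_ a₂ (cong not r₂)) vv stop))

    -- The removed edge charged to a unit z.  A unit z ∉ {u, v} lies on the path u–z–v.
    -- If u and v are both units, the edge u–v alone cannot serve both, and one of them
    -- is charged an edge of the path u–w–v instead.
    data Partner (z : 𝐇) : 𝐇 → Set where
      u↦w : z ≡ u → inU v ≡ true → removed F w v ≡ false → Partner z w
      u↦v : z ≡ u → (inU v ≡ true → removed F w v ≡ true) → Partner z v
      v↦w : z ≢ u → z ≡ v → inU u ≡ true → removed F w v ≡ true → Partner z w
      v↦u : z ≢ u → z ≡ v → (inU u ≡ true → removed F w v ≡ false) → Partner z u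
      fresh↦u : z ≢ u → z ≢ v → removed F u z ≡ true → Partner z u
      fresh↦v : z ≢ u → z ≢ v → removed F u z ≡ false → Partner z v

    private
      choose : ∀ z → ∃ (Partner z)
      choose z = by-cases (z ≟H u) (z ≟H v) (inU u) refl (inU v) refl (removed F w v) refl (removed F u z) refl
        where
        by-cases : Dec (z ≡ u) → Dec (z ≡ v) → ∀ a → inU u ≡ a → ∀ b → inU v ≡ b →
                   ∀ c → removed F w v ≡ c → ∀ d → removed F u z ≡ d → ∃ (Partner z)
        by-cases (yes z≡u) _ _ _ true ev false r _ _ = w , u↦w z≡u ev r
        by-cases (yes z≡u) _ _ _ true _ true r _ _ = v , u↦v z≡u (λ _ → r)
        by-cases (yes z≡u) _ _ _ false ev _ _ _ _ = v , u↦v z≡u (⊥-elim ∘ false≢true ∘ trans (sym ev))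
        by-cases (no z≢u) (yes z≡v) true eu _ _ true r _ _ = w , v↦w z≢u z≡v eu r
        by-cases (no z≢u) (yes z≡v) true _ _ _ false r _ _ = u , v↦u z≢u z≡v (λ _ → r)
        by-cases (no z≢u) (yes z≡v) false eu _ _ _ _ _ _ = u , v↦u z≢u z≡v (⊥-elim ∘ false≢true ∘ trans (sym eu))
        by-cases (no z≢u) (no z≢v) _ _ _ _ _ _ true r = u , fresh↦u z≢u z≢v r
        by-cases (no z≢u) (no z≢v) _ _ _ _ _ _ false r = v , fresh↦v z≢u z≢v r

      partner-isV : ∀ {z p} → Partner z p → isV p ≡ true
      partner-isV (u↦w _ _ _) = w-isV
      partner-isV (u↦v _ _) = vv
      partner-isV (v↦w _ _ _ _) = w-isV
      partner-isV (v↦u _ _ _) = vu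
      partner-isV (fresh↦u _ _ _) = vu
      partner-isV (fresh↦v _ _ _) = vv

      partner-≢ : ∀ {z p} → inU z ≡ true → Partner z p → z ≢ p
      partner-≢ uz (u↦w _ _ _) = inU⇒≢w uz
      partner-≢ uz (u↦v refl _) = u≢v
      partner-≢ uz (v↦w _ _ _ _) = inU⇒≢w uz
      partner-≢ uz (v↦u z≢u _ _) = z≢u
      partner-≢ uz (fresh↦u z≢u _ _) = z≢u
      partner-≢ uz (fresh↦v _ z≢v _) = z≢v

      partner-removed : ∀ {z p} → inU z ≡ true → Partner z p → removed F z p ≡ true
      partner-removed uz (u↦w refl uv r) = ¬-not λ r′ → false≢true (trans (sym r) (removed-on-path w-isV
        (unit-adjacent uz w-isV (inU⇒≢w uz)) (adj-sym {x = v} {y = w} (unit-adjacent uv w-isV (inU⇒≢w uv))) r′))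
      partner-removed uz (u↦v refl _) = removed-if-adj (unit-adjacent uz vv u≢v)
      partner-removed uz (v↦w _ refl _ r) = trans (removed-sym F v w) r
      partner-removed uz (v↦u v≢u refl _) =
        trans (removed-sym F v u) (removed-if-adj (adj-sym {x = v} {y = u} (unit-adjacent uz vu v≢u)))
      partner-removed uz (fresh↦u _ _ r) = trans (removed-sym F _ u) r
      partner-removed {z} uz (fresh↦v z≢u z≢v r) =
        removed-on-path (inU⇒isV uz) (adj-sym {x = z} {y = u} (unit-adjacent uz vu z≢u))
          (unit-adjacent uz vv z≢v) r

      partner-of-u : ∀ {p} → Partner u p → p ≡ w ⊎ p ≡ v × (inU v ≡ true → removed F w v ≡ true)
      partner-of-u (u↦w _ _ _) = inj₁ refl
      partner-of-u (u↦v _ c) = inj₂ (refl , c)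
      partner-of-u (v↦w u≢u _ _ _) = ⊥-elim (u≢u refl)
      partner-of-u (v↦u u≢u _ _) = ⊥-elim (u≢u refl)
      partner-of-u (fresh↦u u≢u _ _) = ⊥-elim (u≢u refl)
      partner-of-u (fresh↦v u≢u _ _) = ⊥-elim (u≢u refl)

      partner-of-v : ∀ {p} → Partner v p → p ≡ w ⊎ p ≡ u × (inU u ≡ true → removed F w v ≡ false)
      partner-of-v (u↦w v≡u _ _) = ⊥-elim (u≢v (sym v≡u))
      partner-of-v (u↦v v≡u _) = ⊥-elim (u≢v (sym v≡u))
      partner-of-v (v↦w _ _ _ _) = inj₁ refl
      partner-of-v (v↦u _ _ c) = inj₂ (refl , c)
      partner-of-v (fresh↦u _ v≢v _) = ⊥-elim (v≢v refl)
      partner-of-v (fresh↦v _ v≢v _) = ⊥-elim (v≢v refl)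

      no-mutual-partners : ∀ {z z′ p p′} → inU z ≡ true → inU z′ ≡ true →
                           Partner z p → Partner z′ p′ → p ≡ z′ → p′ ≡ z → ⊥
      no-mutual-partners uz uz′ (u↦w _ _ _) _ refl _ = inU⇒≢w uz′ refl
      no-mutual-partners uz uz′ (v↦w _ _ _ _) _ refl _ = inU⇒≢w uz′ refl
      no-mutual-partners uz uz′ (u↦v refl c) s′ refl refl =
        Sum.[ inU⇒≢w uz , (λ (_ , c′) → false≢true (trans (sym (c′ uz)) (c uz′))) ]′ (partner-of-v s′)
      no-mutual-partners uz uz′ (v↦u _ refl c) s′ refl refl =
        Sum.[ inU⇒≢w uz , (λ (_ , c′) → false≢true (trans (sym (c uz′)) (c′ uz))) ]′ (partner-of-u s′)
      no-mutual-partners uz uz′ (fresh↦u _ z≢v _) s′ refl refl =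
        Sum.[ inU⇒≢w uz , z≢v ∘ proj₁ ]′ (partner-of-u s′)
      no-mutual-partners uz uz′ (fresh↦v z≢u _ _) s′ refl refl =
        Sum.[ inU⇒≢w uz , z≢u ∘ proj₁ ]′ (partner-of-v s′)

      chargedEdge : 𝐇 → 𝐇 × 𝐇
      chargedEdge z = sortByCode z (proj₁ (choose z))

    |U|≤cut-size : |U| (suc j) ≤ esize (suc j) F
    |U|≤cut-size = length-≤-of-injection chargedEdge (cutEdges F) (U-list-unique {suc j}) into injective
      where
      into : ∀ {z} → z ∈ U-list → chargedEdge z ∈ cutEdges F
      into {z} m = let uz = ∈-U-list⁻ m ; _ , s = choose z in
        ∈-cutEdges F (partner-≢ uz s) (unit-adjacent uz (partner-isV s) (partner-≢ uz s)) (partner-removed uz s)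
      injective : ∀ {z z′} → z ∈ U-list → z′ ∈ U-list → chargedEdge z ≡ chargedEdge z′ → z ≡ z′
      injective {z} {z′} m m′ eq = by-cases (≈ᵤ-trans (≈ᵤ-sym (sortPair-≈ᵤ code z p))
        (subst (_≈ᵤ (z′ , p′)) (sym eq) (sortPair-≈ᵤ code z′ p′)))
        where
        p = proj₁ (choose z)
        p′ = proj₁ (choose z′)
        by-cases : (z , p) ≈ᵤ (z′ , p′) → z ≡ z′
        by-cases (inj₁ (z≡z′ , _)) = z≡z′
        by-cases (inj₂ (z≡p′ , p≡z′)) = ⊥-elim (no-mutual-partners (∈-U-list⁻ m) (∈-U-list⁻ m′)
          (proj₂ (choose z)) (proj₂ (choose z′)) p≡z′ (sym z≡p′))

  vertexConnectivity : VertexConnectivity (suc j) (|U| (suc j))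
  vertexConnectivity = (inU , U-isVertexCut , refl) , λ S cut → count-mono (U⊆vertexCut cut)

  edgeConnectivity : EdgeConnectivity (suc j) (|U| (suc j))
  edgeConnectivity = (F₀ , F₀-isEdgeCut , ℕ.≤-antisym F₀-size≤|U| (lower-bound F₀ F₀-isEdgeCut))
                   , lower-bound
    where
    lower-bound : ∀ F → IsEdgeCut (suc j) F → |U| (suc j) ≤ esize (suc j) F
    lower-bound F (_ , _ , _ , vu , vv , ¬walk) = |U|≤cut-size F vu vv ¬walk

proposition4p8 : (n : ℕ) → 1 ≤ n →
    VertexConnectivity n (|U| n) × EdgeConnectivity n (|U| n)
proposition4p8 (suc j) _ = vertexConnectivity , edgeConnectivity
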